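{- For any graph $G=(V,E)$ and any set $X\subseteq V$, a set $S$ is a minimum power dominating set of $G$ subject to $X$ if and only if $S$ is a minimum power dominating set of $\ell_3(G,X)$.
   Context: All graphs are finite, simple and undirected. For $X\subseteq V(G)$, $\ell_r(G,X)$ denotes the graph obtained from $G$ by attaching $r$ new leaves (new vertices of degree one) to each vertex of $X$. $N(v)$ denotes the set of neighbors of $v$, $N[v]=N(v)\cup\{v\}$, $N[S]=\bigcup_{v\in S}N[v]$. For $S\subseteq V$, the set $PD(S)$ is defined by: initially $PD(S)=N[S]$; while there exists $v\in PD(S)$ with $|N(v)\setminus PD(S)|=1$, replace $PD(S)$ by $PD(S)\cup N(v)$. $S$ is a power dominating set if at the end $PD(S)$ is the whole vertex set. A minimum power dominating set of $G$ subject to $X$ is a power dominating set of $G$ containing $X$ of minimum cardinality among all such sets; a minimum power dominating set of a graph is one of minimum cardinality. -}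

module Defs where

open import Data.Nat using (ℕ; zero; suc; _+_; _*_; _≤_)
open import Data.Bool using (Bool; true; false)
open import Data.Fin using (Fin; zero; suc; splitAt; remQuot)
open import Data.Fin.Subset using (Subset; _∈_; _⊆_; ∣_∣; inside; outside)
open import Data.Vec using (Vec; []; _∷_; _++_; replicate)
open import Data.Sum using (_⊎_; inj₁; inj₂)
open import Data.Product using (_×_; proj₁)
open import Data.Empty using (⊥)
open import Relation.Nullary using (¬_)
open import Relation.Binary.PropositionalEquality using (_≡_; _≢_; refl)

record Graph (n : ℕ) : Set₁ where
  field
    Adj    : Fin n → Fin n → Set
    adj-sym    : ∀ {u v} → Adj u v → Adj v u
    adj-irrefl : ∀ {v} → ¬ Adj v v

open Graph public

-- PD G S v : "v belongs to the final set PD(S)".  This is the closure of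
-- N[S] under the propagation rule: if u ∈ PD(S) and w is the unique
-- neighbour of u outside PD(S), then w is added.

data PD {n : ℕ} (G : Graph n) (S : Subset n) : Fin n → Set where
  inS   : ∀ {v} → v ∈ S → PD G S v
  nbrS  : ∀ {u v} → u ∈ S → Adj G u v → PD G S v
  force : ∀ {u w} → PD G S u → Adj G u w →
          (∀ x → Adj G u x → x ≢ w → PD G S x) → PD G S w

IsPDS : {n : ℕ} → Graph n → Subset n → Set
IsPDS G S = ∀ v → PD G S v

IsMinPDSSubject : {n : ℕ} → Graph n → Subset n → Subset n → Set
IsMinPDSSubject G X S =
  X ⊆ S × IsPDS G S × (∀ T → X ⊆ T → IsPDS G T → ∣ S ∣ ≤ ∣ T ∣)

IsMinPDS : {n : ℕ} → Graph n → Subset n → Set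
IsMinPDS G S = IsPDS G S × (∀ T → IsPDS G T → ∣ S ∣ ≤ ∣ T ∣)

-- The first n vertices are the
-- vertices of G (via splitAt n); a leaf index l : Fin (∣X∣ * r) is the pair
-- (j , t) = remQuot r l and is attached to the j-th element of X.

elemAt : {n : ℕ} (X : Subset n) → Fin ∣ X ∣ → Fin n
elemAt (true ∷ X)  zero    = zero
elemAt (true ∷ X)  (suc j) = suc (elemAt X j)
elemAt (false ∷ X) j       = suc (elemAt X j)

leafBase : {n : ℕ} (X : Subset n) (r : ℕ) → Fin (∣ X ∣ * r) → Fin n
leafBase X r l = elemAt X (proj₁ (remQuot r l))

module _ {n : ℕ} (G : Graph n) (X : Subset n) (r : ℕ) where

  private
    m = ∣ X ∣ * r

    AdjSplit : Fin n ⊎ Fin m → Fin n ⊎ Fin m → Set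
    AdjSplit (inj₁ u) (inj₁ v) = Adj G u v
    AdjSplit (inj₁ u) (inj₂ l) = leafBase X r l ≡ u
    AdjSplit (inj₂ l) (inj₁ u) = leafBase X r l ≡ u
    AdjSplit (inj₂ _) (inj₂ _) = ⊥

    symSplit : ∀ a b → AdjSplit a b → AdjSplit b a
    symSplit (inj₁ u) (inj₁ v) e = Graph.adj-sym G e
    symSplit (inj₁ u) (inj₂ l) e = e
    symSplit (inj₂ l) (inj₁ u) e = e
    symSplit (inj₂ _) (inj₂ _) ()

    irreflSplit : ∀ a → ¬ AdjSplit a a
    irreflSplit (inj₁ u) e = Graph.adj-irrefl G e
    irreflSplit (inj₂ _) ()

  leaves : Graph (n + m)
  leaves = record
    { Adj    = λ a b → AdjSplit (splitAt n a) (splitAt n b)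
    ; adj-sym    = λ {a} {b} → symSplit (splitAt n a) (splitAt n b)
    ; adj-irrefl = λ {a} → irreflSplit (splitAt n a)
    }

ℓ : {n : ℕ} (r : ℕ) (G : Graph n) (X : Subset n) → Graph (n + ∣ X ∣ * r)
ℓ r G X = leaves G X r

embed : {n : ℕ} (k : ℕ) → Subset n → Subset (n + k)
embed k S = S ++ replicate k outside

-- A leaf of ℓ₃(G,X) is a pendant vertex at its base x ∈ X.  If two pendant
-- twins a, b at x and x itself all lie outside S, then a is never observed:
-- it can only be forced from x, which needs b observed first, and vice versa.
-- Hence a power dominating set U of ℓ₃(G,X) contains x or two leaves at x for
-- every x ∈ X, and a leaf in U can be traded away: drop it if its base is in
-- U, otherwise replace it and a sibling leaf by the base.  So minimum power
-- dominating sets of ℓ₃(G,X) contain no leaves, hence contain X, and on such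
-- sets power domination in ℓ₃(G,X) and in G agree.

module Submission where

open import Defs
open import Data.Nat using (ℕ; suc; _+_; _*_; _≤_; _<_; s≤s; s≤s⁻¹)
open import Data.Nat.Properties using (≤-refl; ≤-trans; n≤1+n; ≤-reflexive; <⇒≤; <⇒≱)
open import Data.Nat.Induction using (<-wellFounded)
open import Data.Bool using (true; false)
open import Data.Fin using (Fin; zero; suc; _↑ˡ_; _↑ʳ_; splitAt; join; combine; _≟_)
open import Data.Fin.Properties
  using (splitAt-↑ˡ; splitAt-↑ʳ; join-splitAt; ↑ˡ-injective; ↑ʳ-injective;
         remQuot-combine; combine-remQuot; combine-injectiveʳ; punchIn-injective; punchInᵢ≢i; 0≢1+n)
open import Data.Fin.Subset using (Subset; ∣_∣; _∈_; _∉_; _⊆_; _∪_; _-_; ⁅_⁆)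
open import Data.Fin.Subset.Properties
  using (_∈?_; ∉⊥; ∣⊥∣≡0; ∪-identityʳ; p⊆p∪q; x∈p∪q⁺; x∈⁅x⁆; x∈p∧x≢y⇒x∈p-y; x∈p⇒∣p-x∣<∣p∣;
         nonempty?; Empty-unique)
open import Data.Vec using (_∷_; []; _++_; here; there)
import Data.Vec as Vec
open import Data.Sum using (_⊎_; inj₁; inj₂; [_,_]′)
open import Data.Product using (Σ; ∃; ∃₂; _×_; _,_; proj₁; proj₂)
open import Data.Empty using (⊥-elim)
open import Function using (_∘_; _on_)
open import Function.Bundles using (_⇔_; mk⇔; Equivalence)
open import Induction.WellFounded using (Acc; acc)
open import Relation.Binary.Construct.On using (wellFounded)
open import Relation.Binary.PropositionalEquality using (_≡_; _≢_; refl; cong; sym; subst; subst₂)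
open import Relation.Nullary using (¬_; yes; no)

∣p∪⁅x⁆∣≤1+∣p∣ : ∀ {n} (p : Subset n) x → ∣ p ∪ ⁅ x ⁆ ∣ ≤ suc ∣ p ∣
∣p∪⁅x⁆∣≤1+∣p∣ (true ∷ p)  zero    rewrite ∪-identityʳ p = n≤1+n _
∣p∪⁅x⁆∣≤1+∣p∣ (false ∷ p) zero    rewrite ∪-identityʳ p = ≤-refl
∣p∪⁅x⁆∣≤1+∣p∣ (true ∷ p)  (suc x) = s≤s (∣p∪⁅x⁆∣≤1+∣p∣ p x)
∣p∪⁅x⁆∣≤1+∣p∣ (false ∷ p) (suc x) = ∣p∪⁅x⁆∣≤1+∣p∣ p x

∣embed∣≡∣p∣ : ∀ {n} k (p : Subset n) → ∣ embed k p ∣ ≡ ∣ p ∣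
∣embed∣≡∣p∣ k []          = ∣⊥∣≡0 k
∣embed∣≡∣p∣ k (true ∷ p)  = cong suc (∣embed∣≡∣p∣ k p)
∣embed∣≡∣p∣ k (false ∷ p) = ∣embed∣≡∣p∣ k p

∈-++⁺ˡ : ∀ {n k} {p : Subset n} {q : Subset k} {x} → x ∈ p → x ↑ˡ k ∈ p ++ q
∈-++⁺ˡ here        = here
∈-++⁺ˡ (there x∈p) = there (∈-++⁺ˡ x∈p)

∈-++⁻ˡ : ∀ {n k} {p : Subset n} {q : Subset k} {x} → x ↑ˡ k ∈ p ++ q → x ∈ p
∈-++⁻ˡ {p = _ ∷ _} {x = zero}  here      = here
∈-++⁻ˡ {p = _ ∷ _} {x = suc x} (there q) = there (∈-++⁻ˡ q)

∈-++⁺ʳ : ∀ {n k} (p : Subset n) {q : Subset k} {y} → y ∈ q → n ↑ʳ y ∈ p ++ q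
∈-++⁺ʳ []      y∈q = y∈q
∈-++⁺ʳ (_ ∷ p) y∈q = there (∈-++⁺ʳ p y∈q)

∈-++⁻ʳ : ∀ {n k} (p : Subset n) {q : Subset k} {y} → n ↑ʳ y ∈ p ++ q → y ∈ q
∈-++⁻ʳ []      y∈q         = y∈q
∈-++⁻ʳ (_ ∷ p) (there y∈q) = ∈-++⁻ʳ p y∈q

elemAt-∈ : ∀ {n} (X : Subset n) j → elemAt X j ∈ X
elemAt-∈ (true ∷ X)  zero    = here
elemAt-∈ (true ∷ X)  (suc j) = there (elemAt-∈ X j)
elemAt-∈ (false ∷ X) j       = there (elemAt-∈ X j)

elemAt-surjective : ∀ {n} (X : Subset n) {x} → x ∈ X → ∃ λ j → elemAt X j ≡ x
elemAt-surjective (true ∷ X)  here = zero , refl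
elemAt-surjective (true ∷ X)  (there x∈X) with elemAt-surjective X x∈X
... | j , refl = suc j , refl
elemAt-surjective (false ∷ X) (there x∈X) with elemAt-surjective X x∈X
... | j , refl = j , refl

module _ {n : ℕ} (G : Graph n) where

  adj⇒≢ : ∀ {u v} → Adj G u v → u ≢ v
  adj⇒≢ u~v refl = adj-irrefl G u~v

  PD-mono : ∀ {S S'} → (∀ {u} → u ∈ S → PD G S' u) → (∀ {u v} → u ∈ S → Adj G u v → PD G S' v) →
            ∀ {v} → PD G S v → PD G S' v
  PD-mono self nbrs (inS v∈S)      = self v∈S
  PD-mono self nbrs (nbrS u∈S u~v) = nbrs u∈S u~v
  PD-mono self nbrs (force u∈PD u~w others) =
    force (PD-mono self nbrs u∈PD) u~w (λ x u~x x≢w → PD-mono self nbrs (others x u~x x≢w))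

  IsPDS-⊆ : ∀ {S S'} → S ⊆ S' → IsPDS G S → IsPDS G S'
  IsPDS-⊆ S⊆S' pds v = PD-mono (inS ∘ S⊆S') (nbrS ∘ S⊆S') (pds v)

  IsPendantAt : Fin n → Fin n → Set
  IsPendantAt x a = Adj G x a × (∀ {u} → Adj G a u → u ≡ x)

  IsPDS-removePendant : ∀ {S x a} → IsPendantAt x a → x ∈ S → IsPDS G S → IsPDS G (S - a)
  IsPDS-removePendant {S} {x} {a} (x~a , a~⇒x) x∈S pds v = PD-mono self nbrs (pds v)
    where
    x∈S-a : x ∈ S - a
    x∈S-a = x∈p∧x≢y⇒x∈p-y x∈S (adj⇒≢ x~a)

    self : ∀ {u} → u ∈ S → PD G (S - a) u
    self {u} u∈S with u ≟ a
    ... | yes refl = nbrS x∈S-a x~a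
    ... | no u≢a   = inS (x∈p∧x≢y⇒x∈p-y u∈S u≢a)

    nbrs : ∀ {u v} → u ∈ S → Adj G u v → PD G (S - a) v
    nbrs {u} u∈S u~v with u ≟ a
    ... | yes refl = subst (PD G (S - a)) (sym (a~⇒x u~v)) (inS x∈S-a)
    ... | no u≢a   = nbrS (x∈p∧x≢y⇒x∈p-y u∈S u≢a) u~v

  pendantTwins-∉PD : ∀ {S x a b} → IsPendantAt x a → IsPendantAt x b → a ≢ b →
                     x ∉ S → a ∉ S → b ∉ S → ¬ PD G S a
  pendantTwins-∉PD _ _ _ _ a∉S _ (inS a∈S) = a∉S a∈S
  pendantTwins-∉PD (_ , a~⇒x) _ _ x∉S _ _ (nbrS u∈S u~a) with a~⇒x (adj-sym G u~a)
  ... | refl = x∉S u∈S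
  pendantTwins-∉PD pa pb a≢b x∉S a∉S b∉S (force _ u~a others) with proj₂ pa (adj-sym G u~a)
  ... | refl = pendantTwins-∉PD pb pa (a≢b ∘ sym) x∉S b∉S a∉S (others _ (proj₁ pb) (a≢b ∘ sym))

module LeafExtension {n : ℕ} (G : Graph n) (X : Subset n) where

  m : ℕ
  m = ∣ X ∣ * 3

  H : Graph (n + m)
  H = ℓ 3 G X

  vertex : Fin n → Fin (n + m)
  vertex v = v ↑ˡ m

  leaf : Fin m → Fin (n + m)
  leaf l = n ↑ʳ l

  base : Fin m → Fin n
  base = leafBase X 3

  data View : Fin (n + m) → Set where
    isVertex : ∀ v → View (vertex v)
    isLeaf   : ∀ l → View (leaf l)

  view : ∀ a → View a
  view a = subst View (join-splitAt n m a) (viewSplit (splitAt n a))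
    where
    viewSplit : ∀ s → View (join n m s)
    viewSplit (inj₁ v) = isVertex v
    viewSplit (inj₂ l) = isLeaf l

  vertex-adj⁺ : ∀ {u v} → Adj G u v → Adj H (vertex u) (vertex v)
  vertex-adj⁺ {u} {v} u~v rewrite splitAt-↑ˡ n u m | splitAt-↑ˡ n v m = u~v

  vertex-adj⁻ : ∀ {u v} → Adj H (vertex u) (vertex v) → Adj G u v
  vertex-adj⁻ {u} {v} u~v rewrite splitAt-↑ˡ n u m | splitAt-↑ˡ n v m = u~v

  base-adj : ∀ l → Adj H (vertex (base l)) (leaf l)
  base-adj l rewrite splitAt-↑ˡ n (base l) m | splitAt-↑ʳ n m l = refl

  leaf-adj⁻ : ∀ {l u} → Adj H (leaf l) (vertex u) → base l ≡ u
  leaf-adj⁻ {l} {u} l~u rewrite splitAt-↑ˡ n u m | splitAt-↑ʳ n m l = l~u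

  leaf≁leaf : ∀ {l l'} → ¬ Adj H (leaf l) (leaf l')
  leaf≁leaf {l} {l'} l~l' rewrite splitAt-↑ʳ n m l | splitAt-↑ʳ n m l' = l~l'

  leaf-pendant : ∀ l → IsPendantAt H (vertex (base l)) (leaf l)
  leaf-pendant l = base-adj l , onlyBase
    where
    onlyBase : ∀ {a} → Adj H (leaf l) a → a ≡ vertex (base l)
    onlyBase {a} l~a with view a
    ... | isVertex v = cong vertex (sym (leaf-adj⁻ l~a))
    ... | isLeaf _   = ⊥-elim (leaf≁leaf l~a)

  base-∈ : ∀ l → base l ∈ X
  base-∈ l = elemAt-∈ X _

  module _ {S : Subset n} (X⊆S : X ⊆ S) where

    leaf-PD : ∀ l → PD H (embed m S) (leaf l)
    leaf-PD l = nbrS (∈-++⁺ˡ (X⊆S (base-∈ l))) (base-adj l)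

    PD-embed⁺ : ∀ {v} → PD G S v → PD H (embed m S) (vertex v)
    PD-embed⁺ (inS v∈S)      = inS (∈-++⁺ˡ v∈S)
    PD-embed⁺ (nbrS u∈S u~v) = nbrS (∈-++⁺ˡ u∈S) (vertex-adj⁺ u~v)
    PD-embed⁺ {w} (force {u} u∈PD u~w others) = force (PD-embed⁺ u∈PD) (vertex-adj⁺ u~w) others⁺
      where
      others⁺ : ∀ a → Adj H (vertex u) a → a ≢ vertex w → PD H (embed m S) a
      others⁺ a u~a a≢w with view a
      ... | isVertex x = PD-embed⁺ (others x (vertex-adj⁻ u~a) (a≢w ∘ cong vertex))
      ... | isLeaf l   = leaf-PD l

    PD-embed⁻ : ∀ {a v} → PD H (embed m S) a → a ≡ vertex v → PD G S v
    PD-embed⁻ (inS v∈S) refl = inS (∈-++⁻ˡ v∈S)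
    PD-embed⁻ (nbrS {u} u∈S u~v) refl with view u
    ... | isVertex _ = nbrS (∈-++⁻ˡ u∈S) (vertex-adj⁻ u~v)
    ... | isLeaf _   = ⊥-elim (∉⊥ (∈-++⁻ʳ S u∈S))
    PD-embed⁻ (force {u} u∈PD u~v others) refl with view u
    ... | isVertex _ = force (PD-embed⁻ u∈PD refl) (vertex-adj⁻ u~v) λ x u~x x≢v →
                         PD-embed⁻ (others _ (vertex-adj⁺ u~x) (x≢v ∘ ↑ˡ-injective m _ _)) refl
    ... | isLeaf l   = inS (X⊆S (subst (_∈ X) (leaf-adj⁻ u~v) (base-∈ l)))

    embed-IsPDS⇔ : IsPDS H (embed m S) ⇔ IsPDS G S
    embed-IsPDS⇔ = mk⇔ (λ pds v → PD-embed⁻ (pds (vertex v)) refl) fromG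
      where
      fromG : IsPDS G S → IsPDS H (embed m S)
      fromG pds a with view a
      ... | isVertex v = PD-embed⁺ (pds v)
      ... | isLeaf l   = leaf-PD l

  leafAt : Fin ∣ X ∣ → Fin 3 → Fin (n + m)
  leafAt j t = leaf (combine j t)

  leafAt-pendant : ∀ j t → IsPendantAt H (vertex (elemAt X j)) (leafAt j t)
  leafAt-pendant j t =
    subst (λ p → IsPendantAt H (vertex (elemAt X (proj₁ p))) (leafAt j t))
          (remQuot-combine j t) (leaf-pendant (combine j t))

  leafAt-injective : ∀ {j t t'} → leafAt j t ≡ leafAt j t' → t ≡ t'
  leafAt-injective {j} {t} {t'} = combine-injectiveʳ j t j t' ∘ ↑ʳ-injective n _ _

  IsPDS-leafPair : ∀ {U j t t'} → IsPDS H U → vertex (elemAt X j) ∉ U → t ≢ t' →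
                   leafAt j t ∈ U ⊎ leafAt j t' ∈ U
  IsPDS-leafPair {U} {j} {t} {t'} pds x∉U t≢t' with leafAt j t ∈? U | leafAt j t' ∈? U
  ... | yes l∈U | _        = inj₁ l∈U
  ... | no _    | yes l'∈U = inj₂ l'∈U
  ... | no l∉U  | no l'∉U  =
    ⊥-elim (pendantTwins-∉PD H (leafAt-pendant j t) (leafAt-pendant j t') (t≢t' ∘ leafAt-injective)
                              x∉U l∉U l'∉U (pds (leafAt j t)))

  IsPDS-embed⇒X⊆ : ∀ {A} → IsPDS H (embed m A) → X ⊆ A
  IsPDS-embed⇒X⊆ {A} pds {x} x∈X with x ∈? A | elemAt-surjective X x∈X
  ... | yes x∈A | _        = x∈A
  ... | no x∉A  | j , refl =
    ⊥-elim ([ noLeaf , noLeaf ]′ (IsPDS-leafPair {t = zero} {t' = suc zero} pds (x∉A ∘ ∈-++⁻ˡ) λ ()))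
    where
    noLeaf : ∀ {t} → leafAt j t ∉ embed m A
    noLeaf = ∉⊥ ∘ ∈-++⁻ʳ A

  IsPDS-exchangeLeafPair : ∀ {U j t t'} → IsPDS H U → leafAt j t ∈ U → leafAt j t' ∈ U → t ≢ t' →
                         ∃ λ U' → IsPDS H U' × ∣ U' ∣ < ∣ U ∣
  IsPDS-exchangeLeafPair {U} {j} {t} {t'} pds l∈U l'∈U t≢t' = U₃ , pds₃ , U₃<U
    where
    x  = vertex (elemAt X j)
    U₁ = U ∪ ⁅ x ⁆
    U₂ = U₁ - leafAt j t
    U₃ = U₂ - leafAt j t'
    x∈U₁ : x ∈ U₁
    x∈U₁ = x∈p∪q⁺ (inj₂ (x∈⁅x⁆ x))
    x∈U₂ : x ∈ U₂
    x∈U₂ = x∈p∧x≢y⇒x∈p-y x∈U₁ (adj⇒≢ H (proj₁ (leafAt-pendant j t)))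
    l'∈U₂ : leafAt j t' ∈ U₂
    l'∈U₂ = x∈p∧x≢y⇒x∈p-y (p⊆p∪q _ l'∈U) (t≢t' ∘ sym ∘ leafAt-injective)
    pds₃ : IsPDS H U₃
    pds₃ = IsPDS-removePendant H (leafAt-pendant j t') x∈U₂
             (IsPDS-removePendant H (leafAt-pendant j t) x∈U₁ (IsPDS-⊆ H (p⊆p∪q _) pds))
    -- ∣ U₃ ∣ + 2 ≤ ∣ U₁ ∣ ≤ ∣ U ∣ + 1
    U₃<U : ∣ U₃ ∣ < ∣ U ∣
    U₃<U = s≤s⁻¹ (≤-trans (s≤s (x∈p⇒∣p-x∣<∣p∣ l'∈U₂))
                          (≤-trans (x∈p⇒∣p-x∣<∣p∣ (p⊆p∪q _ l∈U)) (∣p∪⁅x⁆∣≤1+∣p∣ U x)))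

  IsPDS-shrink : ∀ {U j t} → IsPDS H U → leafAt j t ∈ U → ∃ λ U' → IsPDS H U' × ∣ U' ∣ < ∣ U ∣
  IsPDS-shrink {U} {j} {t} pds l∈U with vertex (elemAt X j) ∈? U
  ... | yes x∈U =
    U - leafAt j t , IsPDS-removePendant H (leafAt-pendant j t) x∈U pds , x∈p⇒∣p-x∣<∣p∣ l∈U
  ... | no x∉U with IsPDS-leafPair pds x∉U (0≢1+n ∘ punchIn-injective t zero (suc zero))
  ... | inj₁ l₁∈U = IsPDS-exchangeLeafPair pds l∈U l₁∈U (punchInᵢ≢i t zero ∘ sym)
  ... | inj₂ l₂∈U = IsPDS-exchangeLeafPair pds l∈U l₂∈U (punchInᵢ≢i t (suc zero) ∘ sym)

  leafless⊎hasLeaf : ∀ U → (∃ λ A → U ≡ embed m A) ⊎ (∃₂ λ j t → leafAt j t ∈ U)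
  leafless⊎hasLeaf U with Vec.splitAt n U
  ... | A , B , refl with nonempty? B
  ... | no B-empty     = inj₁ (A , cong (A ++_) (Empty-unique B-empty))
  ... | yes (l , l∈B) =
    inj₂ (_ , _ , subst (λ l → leaf l ∈ A ++ B) (sym (combine-remQuot {∣ X ∣} 3 l)) (∈-++⁺ʳ A l∈B))

  IsPDS⇒restrictedPDS : ∀ U → IsPDS H U → ∃ λ S → X ⊆ S × IsPDS G S × ∣ S ∣ ≤ ∣ U ∣
  IsPDS⇒restrictedPDS U = descend U (wellFounded ∣_∣ <-wellFounded U)
    where
    descend : ∀ U → Acc (_<_ on ∣_∣) U → IsPDS H U → ∃ λ S → X ⊆ S × IsPDS G S × ∣ S ∣ ≤ ∣ U ∣
    descend U (acc smaller) pds with leafless⊎hasLeaf U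
    ... | inj₁ (A , refl) =
      A , X⊆A , Equivalence.to (embed-IsPDS⇔ X⊆A) pds , ≤-reflexive (sym (∣embed∣≡∣p∣ m A))
      where X⊆A = IsPDS-embed⇒X⊆ pds
    ... | inj₂ (_ , _ , l∈U) with IsPDS-shrink pds l∈U
    ... | U' , pds' , U'<U with descend U' (smaller U'<U) pds'
    ... | S , X⊆S , pdsS , S≤U' = S , X⊆S , pdsS , ≤-trans S≤U' (<⇒≤ U'<U)

  IsMinPDS⇒leafless : ∀ {U} → IsMinPDS H U → ∃ λ A → U ≡ embed m A
  IsMinPDS⇒leafless {U} (pds , minimal) with leafless⊎hasLeaf U
  ... | inj₁ leafless = leafless
  ... | inj₂ (_ , _ , l∈U) with IsPDS-shrink pds l∈U
  ... | U' , pds' , U'<U = ⊥-elim (<⇒≱ U'<U (minimal U' pds'))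

proposition3p6 : {n : ℕ} (G : Graph n) (X : Subset n) (T : Subset (n + ∣ X ∣ * 3)) →
    IsMinPDS (ℓ 3 G X) T ⇔ Σ (Subset n) (λ S → T ≡ embed (∣ X ∣ * 3) S × IsMinPDSSubject G X S)
proposition3p6 {n} G X T = mk⇔ restrict extend
  where
  open LeafExtension G X

  restrict : IsMinPDS H T → Σ (Subset n) λ S → T ≡ embed m S × IsMinPDSSubject G X S
  restrict (pds , minimal) with IsMinPDS⇒leafless (pds , minimal)
  ... | S , refl = S , refl , X⊆S , Equivalence.to (embed-IsPDS⇔ X⊆S) pds , minimalSubject
    where
    X⊆S = IsPDS-embed⇒X⊆ pds
    minimalSubject : ∀ S' → X ⊆ S' → IsPDS G S' → ∣ S ∣ ≤ ∣ S' ∣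
    minimalSubject S' X⊆S' pdsS' =
      subst₂ _≤_ (∣embed∣≡∣p∣ m S) (∣embed∣≡∣p∣ m S')
             (minimal (embed m S') (Equivalence.from (embed-IsPDS⇔ X⊆S') pdsS'))

  extend : Σ (Subset n) (λ S → T ≡ embed m S × IsMinPDSSubject G X S) → IsMinPDS H T
  extend (S , refl , X⊆S , pdsS , minimal) = Equivalence.from (embed-IsPDS⇔ X⊆S) pdsS , minimalH
    where
    minimalH : ∀ U → IsPDS H U → ∣ embed m S ∣ ≤ ∣ U ∣
    minimalH U pdsU with IsPDS⇒restrictedPDS U pdsU
    ... | S' , X⊆S' , pdsS' , S'≤U =
      subst (_≤ ∣ U ∣) (sym (∣embed∣≡∣p∣ m S)) (≤-trans (minimal S' X⊆S' pdsS') S'≤U)
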